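{- For all formulae $A,B$, the formula $(\top^*\wedge(A*B))\to A$ is provable in $LS_{BBI}+D$, i.e. $\emptyset;\emptyset\vdash w:(\top^*\wedge(A*B))\to A$ is derivable in that calculus for a label variable $w$.
   Context: Formulae: $A ::= p \mid \top\mid\bot\mid\neg A\mid A\vee A\mid A\wedge A\mid A\to A\mid \top^*\mid A*A\mid A\mathrel{ -\!\!*}A$. Labels: $LVar\cup\{\epsilon\}$ ($LVar$ infinite set of label variables, $\epsilon$ a constant). Labelled formula $a:A$; relational atom $(a,b\triangleright c)$. Sequent $\mathcal{G};\Gamma\vdash\Delta$: $\mathcal{G}$ a set of relational atoms, $\Gamma,\Delta$ multisets of labelled formulae; commas denote union. $[y/x]$ ($x$ a label variable) is uniform replacement. $\neg A$ abbreviates $A\to\bot$, $A\vee B$ abbreviates $\neg A\to B$. The calculus $LS_{BBI}$ has the rules (premises $\Rightarrow$ conclusion; fresh = label variable not in conclusion): $id$: axiom $\mathcal{G};\Gamma,w:p\vdash w:p,\Delta$ ($p$ a propositional variable); $cut$: $\mathcal{G};\Gamma\vdash x:A,\Delta$ and $\mathcal{G}';\Gamma',x:A\vdash\Delta'\Rightarrow\mathcal{G},\mathcal{G}';\Gamma,\Gamma'\vdash\Delta,\Delta'$; $\bot L$: axiom $\mathcal{G};\Gamma,w:\bot\vdash\Delta$; $\top R$: axiom $\mathcal{G};\Gamma\vdash w:\top,\Delta$; $\top^*R$: axiom $\mathcal{G};\Gamma\vdash\epsilon:\top^*,\Delta$; $\top^*L$: $(\epsilon,w\triangleright\epsilon),\mathcal{G};\Gamma\vdash\Delta\Rightarrow\mathcal{G};\Gamma,w:\top^*\vdash\Delta$;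 $\wedge L$: $\mathcal{G};\Gamma,w:A,w:B\vdash\Delta\Rightarrow\mathcal{G};\Gamma,w:A\wedge B\vdash\Delta$; $\wedge R$: $\mathcal{G};\Gamma\vdash w:A,\Delta$ and $\mathcal{G};\Gamma\vdash w:B,\Delta\Rightarrow\mathcal{G};\Gamma\vdash w:A\wedge B,\Delta$; $\to L$: $\mathcal{G};\Gamma\vdash w:A,\Delta$ and $\mathcal{G};\Gamma,w:B\vdash\Delta\Rightarrow\mathcal{G};\Gamma,w:A\to B\vdash\Delta$; $\to R$: $\mathcal{G};\Gamma,w:A\vdash w:B,\Delta\Rightarrow\mathcal{G};\Gamma\vdash w:A\to B,\Delta$; $*L$: $(x,y\triangleright z),\mathcal{G};\Gamma,x:A,y:B\vdash\Delta\Rightarrow\mathcal{G};\Gamma,z:A*B\vdash\Delta$ ($x,y$ fresh); $\mathrel{ -\!\!*}R$: $(x,z\triangleright y),\mathcal{G};\Gamma,x:A\vdash y:B,\Delta\Rightarrow\mathcal{G};\Gamma\vdash z:A\mathrel{ -\!\!*}B,\Delta$ ($x,y$ fresh); $*R$: $(x,y\triangleright z),\mathcal{G};\Gamma\vdash x:A,z:A*B,\Delta$ and $(x,y\triangleright z),\mathcal{G};\Gamma\vdash y:B,z:A*B,\Delta\Rightarrow(x,y\triangleright z),\mathcal{G};\Gamma\vdash z:A*B,\Delta$; $\mathrel{ -\!\!*}L$: $(x,y\triangleright z),\mathcal{G};\Gamma,y:A\mathrel{ -\!\!*}B\vdash x:A,\Delta$ and $(x,y\triangleright z),\mathcal{G};\Gamma,y:A\mathrel{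 -\!\!*}B,z:B\vdash\Delta\Rightarrow(x,y\triangleright z),\mathcal{G};\Gamma,y:A\mathrel{ -\!\!*}B\vdash\Delta$; $E$: $(y,x\triangleright z),(x,y\triangleright z),\mathcal{G};\Gamma\vdash\Delta\Rightarrow(x,y\triangleright z),\mathcal{G};\Gamma\vdash\Delta$; $A$: $(u,w\triangleright z),(y,v\triangleright w),(x,y\triangleright z),(u,v\triangleright x),\mathcal{G};\Gamma\vdash\Delta\Rightarrow(x,y\triangleright z),(u,v\triangleright x),\mathcal{G};\Gamma\vdash\Delta$ ($w$ fresh); $U$: $(x,\epsilon\triangleright x),\mathcal{G};\Gamma\vdash\Delta\Rightarrow\mathcal{G};\Gamma\vdash\Delta$; $A_C$: $(x,w\triangleright x),(y,y\triangleright w),(x,y\triangleright x),\mathcal{G};\Gamma\vdash\Delta\Rightarrow(x,y\triangleright x),\mathcal{G};\Gamma\vdash\Delta$ ($w$ fresh); $Eq_1$: $(\epsilon,w'\triangleright w'),\mathcal{G}[w'/w];\Gamma[w'/w]\vdash\Delta[w'/w]\Rightarrow(\epsilon,w\triangleright w'),\mathcal{G};\Gamma\vdash\Delta$; $Eq_2$: same premise $\Rightarrow(\epsilon,w'\triangleright w),\mathcal{G};\Gamma\vdash\Delta$ (in $Eq_1,Eq_2$, $w$ a label variable). $LS_{BBI}+D$ adds the rule $D$: $(\epsilon,\epsilon\triangleright y),\mathcal{G}[\epsilon/x];\Gamma[\epsilon/x]\vdash\Delta[\epsilon/x]\Rightarrow(x,x\triangleright y),\mathcal{G};\Gamma\vdash\Delta$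 ($x$ a label variable). -}

module Defs where

open import Data.Nat using (ℕ; _≡ᵇ_)
open import Data.Bool using (if_then_else_)
open import Data.List using (List; []; _∷_; _++_; map; concatMap)
open import Data.List.Membership.Propositional using (_∉_)
open import Data.List.Relation.Binary.Subset.Propositional using (_⊆_)
open import Data.List.Relation.Binary.Permutation.Propositional using (_↭_)
open import Data.Product using (_×_)
open import Relation.Binary.PropositionalEquality using (_≢_)

infixr 6 _∧′_
infixr 5 _→′_
infixr 7 _∗_
infixr 5 _-∗_

data Form : Set where
  pv   : ℕ → Form
  ⊤′   : Form
  ⊥′   : Form
  _∧′_ : Form → Form → Form
  _→′_ : Form → Form → Form
  ⊤*   : Form
  _∗_  : Form → Form → Form
  _-∗_ : Form → Form → Form

¬′_ : Form → Form
¬′ A = A →′ ⊥′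

_∨′_ : Form → Form → Form
A ∨′ B = (¬′ A) →′ B

data Label : Set where
  lv : ℕ → Label
  ε  : Label

record LForm : Set where
  constructor _∶_
  field
    lab  : Label
    form : Form
open LForm public

record RAtom : Set where
  constructor ⟨_,_▷_⟩
  field
    r₁ r₂ r₃ : Label
open RAtom public

infix 4 _∶_

substLab : Label → ℕ → Label → Label
substLab y x (lv n) = if n ≡ᵇ x then y else lv n
substLab y x ε      = ε

substA : Label → ℕ → RAtom → RAtom
substA y x ⟨ a , b ▷ c ⟩ = ⟨ substLab y x a , substLab y x b ▷ substLab y x c ⟩

substF : Label → ℕ → LForm → LForm
substF y x (a ∶ A) = substLab y x a ∶ A

substG : Label → ℕ → List RAtom → List RAtom
substG y x = map (substA y x)

substΓ : Label → ℕ → List LForm → List LForm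
substΓ y x = map (substF y x)

atomLabels : RAtom → List Label
atomLabels ⟨ a , b ▷ c ⟩ = a ∷ b ∷ c ∷ []

seqLabels : List RAtom → List LForm → List LForm → List Label
seqLabels G Γ Δ = concatMap atomLabels G ++ map lab Γ ++ map lab Δ

Fresh : ℕ → List RAtom → List LForm → List LForm → Set
Fresh x G Γ Δ = lv x ∉ seqLabels G Γ Δ

-- G is a set of relational atoms: lists are identified up to
-- having the same elements.
_≈ₛ_ : List RAtom → List RAtom → Set
G ≈ₛ G' = (G ⊆ G') × (G' ⊆ G)

-- A sequent G ; Γ ⊢ Δ is represented by three lists; the structural
-- rule `reorder` identifies lists up to set-equality (for G) and up to
-- permutation, i.e. multiset equality (for Γ and Δ).  Thus each rule is
-- stated with its principal formulae / atoms at the head of the lists.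

infix 3 _⨾_⊢_

data _⨾_⊢_ : List RAtom → List LForm → List LForm → Set where
  reorder : ∀ {G G' Γ Γ' Δ Δ'} → G ≈ₛ G' → Γ ↭ Γ' → Δ ↭ Δ' →
            G ⨾ Γ ⊢ Δ → G' ⨾ Γ' ⊢ Δ'
  id   : ∀ {G Γ Δ w p} → G ⨾ (w ∶ pv p) ∷ Γ ⊢ (w ∶ pv p) ∷ Δ
  cut  : ∀ {G G' Γ Γ' Δ Δ' x A} →
         G ⨾ Γ ⊢ (x ∶ A) ∷ Δ → G' ⨾ (x ∶ A) ∷ Γ' ⊢ Δ' →
         G ++ G' ⨾ Γ ++ Γ' ⊢ Δ ++ Δ'
  ⊥L   : ∀ {G Γ Δ w} → G ⨾ (w ∶ ⊥′) ∷ Γ ⊢ Δ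
  ⊤R   : ∀ {G Γ Δ w} → G ⨾ Γ ⊢ (w ∶ ⊤′) ∷ Δ
  ⊤*R  : ∀ {G Γ Δ} → G ⨾ Γ ⊢ (ε ∶ ⊤*) ∷ Δ
  ⊤*L  : ∀ {G Γ Δ w} → ⟨ ε , w ▷ ε ⟩ ∷ G ⨾ Γ ⊢ Δ → G ⨾ (w ∶ ⊤*) ∷ Γ ⊢ Δ
  ∧L   : ∀ {G Γ Δ w A B} → G ⨾ (w ∶ A) ∷ (w ∶ B) ∷ Γ ⊢ Δ →
         G ⨾ (w ∶ A ∧′ B) ∷ Γ ⊢ Δ
  ∧R   : ∀ {G Γ Δ w A B} → G ⨾ Γ ⊢ (w ∶ A) ∷ Δ → G ⨾ Γ ⊢ (w ∶ B) ∷ Δ →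
         G ⨾ Γ ⊢ (w ∶ A ∧′ B) ∷ Δ
  →L   : ∀ {G Γ Δ w A B} → G ⨾ Γ ⊢ (w ∶ A) ∷ Δ → G ⨾ (w ∶ B) ∷ Γ ⊢ Δ →
         G ⨾ (w ∶ A →′ B) ∷ Γ ⊢ Δ
  →R   : ∀ {G Γ Δ w A B} → G ⨾ (w ∶ A) ∷ Γ ⊢ (w ∶ B) ∷ Δ →
         G ⨾ Γ ⊢ (w ∶ A →′ B) ∷ Δ
  ∗L   : ∀ {G Γ Δ x y z A B} →
         Fresh x G ((z ∶ A ∗ B) ∷ Γ) Δ → Fresh y G ((z ∶ A ∗ B) ∷ Γ) Δ → x ≢ y →
         ⟨ lv x , lv y ▷ z ⟩ ∷ G ⨾ (lv x ∶ A) ∷ (lv y ∶ B) ∷ Γ ⊢ Δ →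
         G ⨾ (z ∶ A ∗ B) ∷ Γ ⊢ Δ
  -∗R  : ∀ {G Γ Δ x y z A B} →
         Fresh x G Γ ((z ∶ A -∗ B) ∷ Δ) → Fresh y G Γ ((z ∶ A -∗ B) ∷ Δ) → x ≢ y →
         ⟨ lv x , z ▷ lv y ⟩ ∷ G ⨾ (lv x ∶ A) ∷ Γ ⊢ (lv y ∶ B) ∷ Δ →
         G ⨾ Γ ⊢ (z ∶ A -∗ B) ∷ Δ
  ∗R   : ∀ {G Γ Δ x y z A B} →
         ⟨ x , y ▷ z ⟩ ∷ G ⨾ Γ ⊢ (x ∶ A) ∷ (z ∶ A ∗ B) ∷ Δ →
         ⟨ x , y ▷ z ⟩ ∷ G ⨾ Γ ⊢ (y ∶ B) ∷ (z ∶ A ∗ B) ∷ Δ →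
         ⟨ x , y ▷ z ⟩ ∷ G ⨾ Γ ⊢ (z ∶ A ∗ B) ∷ Δ
  -∗L  : ∀ {G Γ Δ x y z A B} →
         ⟨ x , y ▷ z ⟩ ∷ G ⨾ (y ∶ A -∗ B) ∷ Γ ⊢ (x ∶ A) ∷ Δ →
         ⟨ x , y ▷ z ⟩ ∷ G ⨾ (y ∶ A -∗ B) ∷ (z ∶ B) ∷ Γ ⊢ Δ →
         ⟨ x , y ▷ z ⟩ ∷ G ⨾ (y ∶ A -∗ B) ∷ Γ ⊢ Δ
  E    : ∀ {G Γ Δ x y z} →
         ⟨ y , x ▷ z ⟩ ∷ ⟨ x , y ▷ z ⟩ ∷ G ⨾ Γ ⊢ Δ →
         ⟨ x , y ▷ z ⟩ ∷ G ⨾ Γ ⊢ Δ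
  A    : ∀ {G Γ Δ x y z u v w} →
         Fresh w (⟨ x , y ▷ z ⟩ ∷ ⟨ u , v ▷ x ⟩ ∷ G) Γ Δ →
         ⟨ u , lv w ▷ z ⟩ ∷ ⟨ y , v ▷ lv w ⟩ ∷ ⟨ x , y ▷ z ⟩ ∷ ⟨ u , v ▷ x ⟩ ∷ G ⨾ Γ ⊢ Δ →
         ⟨ x , y ▷ z ⟩ ∷ ⟨ u , v ▷ x ⟩ ∷ G ⨾ Γ ⊢ Δ
  U    : ∀ {G Γ Δ x} → ⟨ x , ε ▷ x ⟩ ∷ G ⨾ Γ ⊢ Δ → G ⨾ Γ ⊢ Δ
  AC   : ∀ {G Γ Δ x y w} →
         Fresh w (⟨ x , y ▷ x ⟩ ∷ G) Γ Δ →
         ⟨ x , lv w ▷ x ⟩ ∷ ⟨ y , y ▷ lv w ⟩ ∷ ⟨ x , y ▷ x ⟩ ∷ G ⨾ Γ ⊢ Δ →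
         ⟨ x , y ▷ x ⟩ ∷ G ⨾ Γ ⊢ Δ
  Eq₁  : ∀ {G Γ Δ w w'} →
         ⟨ ε , w' ▷ w' ⟩ ∷ substG w' w G ⨾ substΓ w' w Γ ⊢ substΓ w' w Δ →
         ⟨ ε , lv w ▷ w' ⟩ ∷ G ⨾ Γ ⊢ Δ
  Eq₂  : ∀ {G Γ Δ w w'} →
         ⟨ ε , w' ▷ w' ⟩ ∷ substG w' w G ⨾ substΓ w' w Γ ⊢ substΓ w' w Δ →
         ⟨ ε , w' ▷ lv w ⟩ ∷ G ⨾ Γ ⊢ Δ
  D    : ∀ {G Γ Δ x y} →
         ⟨ ε , ε ▷ y ⟩ ∷ substG ε x G ⨾ substΓ ε x Γ ⊢ substΓ ε x Δ →
         ⟨ lv x , lv x ▷ y ⟩ ∷ G ⨾ Γ ⊢ Δ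

-- In a model, ⊤* forces w = ε, so A ∗ B at w splits ε as x ∘ y.  Unit,
-- commutativity and associativity give x = ε ∘ x = (y ∘ x) ∘ x = y ∘ (x ∘ x),
-- so x ∘ x is defined, and then D forces x = ε: A holds at x, hence at ε.
module Submission where

open import Defs
open import Data.Nat using (ℕ; suc; _+_; _≤_; _<_; _≟_)
open import Data.Nat.Properties using (≤-trans; ≤-refl; m≤m+n; m≤n+m; n≤1+n; 1+n≢n; <⇒≱; ≡⇒≡ᵇ)
open import Data.List using (List; []; _∷_)
open import Data.List.Relation.Unary.Any using (here; there)
open import Data.List.Membership.Propositional using (_∈_; _∉_)
open import Data.List.Relation.Binary.Permutation.Propositional using (_↭_; ↭-refl; ↭-sym; prep; swap)
open import Data.List.Relation.Binary.Permutation.Propositional.Properties using (∈-resp-↭)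
open import Data.Product using (_,_)
open import Data.Unit using (tt)
open import Relation.Binary.Definitions using (DecidableEquality)
open import Relation.Binary.PropositionalEquality using (_≡_; refl; cong)
open import Relation.Nullary.Decidable using (False; toWitnessFalse; yes; no; map′)
open import Data.Bool.Properties using (T-≡)
open import Function.Bundles using (Equivalence)

↭⇒≈ₛ : {G G' : List RAtom} → G ↭ G' → G ≈ₛ G'
↭⇒≈ₛ p = ∈-resp-↭ p , ∈-resp-↭ (↭-sym p)

reorderG : ∀ {G G' Γ Δ} → G ↭ G' → G ⨾ Γ ⊢ Δ → G' ⨾ Γ ⊢ Δ
reorderG p = reorder (↭⇒≈ₛ p) ↭-refl ↭-refl

reorderΓ : ∀ {G Γ Γ' Δ} → Γ ↭ Γ' → G ⨾ Γ ⊢ Δ → G ⨾ Γ' ⊢ Δ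
reorderΓ p = reorder (↭⇒≈ₛ ↭-refl) p ↭-refl

swap-head : {X : Set} {a b : X} {xs : List X} → a ∷ b ∷ xs ↭ b ∷ a ∷ xs
swap-head = swap _ _ ↭-refl

substLab-self : ∀ y n → substLab y n (lv n) ≡ y
substLab-self y n rewrite Equivalence.to T-≡ (≡⇒≡ᵇ n n refl) = refl

_≟ˡ_ : DecidableEquality Label
lv m ≟ˡ lv n = map′ (cong lv) (λ { refl → refl }) (m ≟ n)
lv m ≟ˡ ε    = no λ ()
ε    ≟ˡ lv n = no λ ()
ε    ≟ˡ ε    = yes refl

open import Data.List.Membership.DecPropositional _≟ˡ_ using (_∈?_)

∉-by-evaluation : ∀ {x ls} → False (lv x ∈? ls) → lv x ∉ ls
∉-by-evaluation = toWitnessFalse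

labelSum : List Label → ℕ
labelSum []            = 0
labelSum (lv n ∷ ls) = n + labelSum ls
labelSum (ε ∷ ls)    = labelSum ls

∈⇒≤labelSum : ∀ {n} ls → lv n ∈ ls → n ≤ labelSum ls
∈⇒≤labelSum (lv n ∷ ls) (here refl) = m≤m+n n (labelSum ls)
∈⇒≤labelSum (lv m ∷ ls) (there p)   = ≤-trans (∈⇒≤labelSum ls p) (m≤n+m _ m)
∈⇒≤labelSum (ε ∷ ls)    (there p)   = ∈⇒≤labelSum ls p

>labelSum⇒∉ : ∀ {n} ls → labelSum ls < n → lv n ∉ ls
>labelSum⇒∉ ls sum<n n∈ls = <⇒≱ sum<n (∈⇒≤labelSum ls n∈ls)

⊤*R-at : ∀ {G Γ Δ l} → l ≡ ε → G ⨾ Γ ⊢ (l ∶ ⊤*) ∷ Δ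
⊤*R-at refl = ⊤*R

identity : ∀ C {G Γ Δ a} → G ⨾ (a ∶ C) ∷ Γ ⊢ (a ∶ C) ∷ Δ
identity (pv p)   = id
identity ⊤′       = ⊤R
identity ⊥′       = ⊥L
identity (C ∧′ F) = ∧L (∧R (identity C) (reorderΓ swap-head (identity F)))
identity (C →′ F) = →R (reorderΓ swap-head (→L (identity C) (identity F)))
identity ⊤* {a = ε}    = ⊤*L ⊤*R
identity ⊤* {a = lv n} = ⊤*L (Eq₁ (⊤*R-at (substLab-self ε n)))
identity (C ∗ F) {G} {Γ} {Δ} {a} =
  ∗L {x = suc (suc (labelSum ls))} {y = suc (labelSum ls)}
     (>labelSum⇒∉ ls (n≤1+n _)) (>labelSum⇒∉ ls ≤-refl) 1+n≢n
     (∗R (identity C) (reorderΓ swap-head (identity F)))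
  where ls = seqLabels G ((a ∶ C ∗ F) ∷ Γ) ((a ∶ C ∗ F) ∷ Δ)
identity (C -∗ F) {G} {Γ} {Δ} {a} =
  -∗R {x = suc (suc (labelSum ls))} {y = suc (labelSum ls)}
      (>labelSum⇒∉ ls (n≤1+n _)) (>labelSum⇒∉ ls ≤-refl) 1+n≢n
      (reorderΓ swap-head
        (-∗L (reorderΓ swap-head (identity C)) (reorderΓ swap-head (identity F))))
  where ls = seqLabels G ((a ∶ C -∗ F) ∷ Γ) ((a ∶ C -∗ F) ∷ Δ)

-- With x = lv 0 and y = lv 1, U and A produce the atom x ∘ x = lv 2,
-- on which D substitutes ε for x.
left-factor-of-ε : ∀ {P Q} →
  ⟨ lv 0 , lv 1 ▷ ε ⟩ ∷ ⟨ ε , ε ▷ ε ⟩ ∷ [] ⨾ (lv 0 ∶ P) ∷ (lv 1 ∶ Q) ∷ [] ⊢ (ε ∶ P) ∷ []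
left-factor-of-ε {P} =
  E (U {x = lv 0} (E (reorderG (prep _ swap-head)
    (A {w = 2} (∉-by-evaluation tt) (reorderG swap-head
      (D {x = 0} (identity P)))))))

split-of-ε : ∀ {P Q} → ⟨ ε , ε ▷ ε ⟩ ∷ [] ⨾ (ε ∶ P ∗ Q) ∷ [] ⊢ (ε ∶ P) ∷ []
split-of-ε = ∗L {x = 0} {y = 1} (∉-by-evaluation tt) (∉-by-evaluation tt) (λ ()) left-factor-of-ε

mainTheorem9 : (A B : Form) (w : ℕ) →
    [] ⨾ [] ⊢ (lv w ∶ (⊤* ∧′ (A ∗ B)) →′ A) ∷ []
mainTheorem9 P Q w = →R (∧L (⊤*L (Eq₁ {w = w} {w' = ε} at-ε)))
  where
  at-ε : ⟨ ε , ε ▷ ε ⟩ ∷ [] ⨾ (substLab ε w (lv w) ∶ P ∗ Q) ∷ [] ⊢ (substLab ε w (lv w) ∶ P) ∷ []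
  at-ε rewrite substLab-self ε w = split-of-ε
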